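{- Let $\Sigma$ be an aggregate signature, $\mathcal D$ a $\Sigma$-structure, $\Pi$ a set of defined predicate symbols, and $P$ a definite $\Sigma(\Pi)$-aggregate program. Then $T_{P,\mathcal D}$ is monotone with respect to $\subseteq$.
   Context: An aggregate relation $R\subseteq\mathcal P(D_1)\times D_2$ is monotone if $(S_1,d)\in R$ and $S_1\subseteq S_2$ imply $(S_2,d)\in R$, anti-monotone if $(S_2,d)\in R$ and $S_1\subseteq S_2$ imply $(S_1,d)\in R$. An aggregate signature $\Sigma$ has sorts, sorted function, predicate and aggregate symbols $\mathsf R:\{s_1\times\dots\times s_n\}\times w$; set expressions $\{(x_1,\dots,x_n)\mid\varphi\}$, aggregate atoms $\mathsf R(s,t)$ and aggregate formulas (atoms, aggregate atoms, closed under $\neg,\wedge,\vee,\forall,\exists$) are defined simultaneously. A $\Sigma$-structure interprets each aggregate symbol by an aggregate relation; a set expression $\{\bar x\mid\varphi(\bar x)\}$ denotes $\{\bar d\mid\mathcal D\models\varphi(\bar d)\}$ and $\mathsf R(s,t)$ holds iff (value of $s$, value of $t$)$\in\mathsf R^{\mathcal D}$; other connectives as in first-order logic. Programs: $\Pi$ is a set of predicate symbols not in $\Sigma$; a rule is $A\leftarrow\varphi$, $A$ a $\Pi$-atom, $\varphi$ a $\Sigma(\Pi)$-aggregate formula; a program is a (possibly infinite) set of rules. Interpretations are subsets $I$ of $base_{\mathcal D}(\Pi)$ (ground $\Pi$-atoms over domain elements); $\mathcal D(I)$ extends $\mathcal D$ making exactly the atoms in $I$ true; $inst_{\mathcal D}(P)$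 is the set of ground instances of rules; $T_{P,\mathcal D}(I)=\{A\mid A\leftarrow\varphi\in inst_{\mathcal D}(P),\ \mathcal D(I)\models\varphi\}$. An occurrence of a predicate in a formula is neutral if it lies inside the condition $\theta$ of an aggregate atom $\mathsf R(\{\bar x\mid\theta\},t)$ with $\mathsf R^{\mathcal D}$ neither monotone nor anti-monotone; otherwise it is positive (resp. negative) if the number of negations and aggregate atoms interpreted by anti-monotone aggregate relations above it is even (resp. odd). A formula is positive if no predicate of $\Pi$ occurs negatively or neutrally. A program is definite if all rule bodies are positive. -}

module Defs where

open import Data.List using (List; []; _∷_; _++_)
open import Data.List.Membership.Propositional using (_∈_)
open import Data.List.Relation.Unary.All as All using (All; []; _∷_)
open import Data.Product using (Σ; _×_; _,_)
open import Data.Sum using (_⊎_)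
open import Data.Empty using (⊥)
open import Relation.Nullary using (¬_)
open import Relation.Binary.PropositionalEquality using (_≡_)

-- Aggregate signatures (many-sorted).
-- An aggregate symbol  R : {s₁ × … × sₙ} × w  has tuple sorts aggTuple R
-- = s₁ … sₙ and result sort aggRes R = w.

record Signature : Set₁ where
  field
    Sort     : Set
    FunSym   : Set
    funArgs  : FunSym → List Sort
    funRes   : FunSym → Sort
    PredSym  : Set
    predArgs : PredSym → List Sort
    AggSym   : Set
    aggTuple : AggSym → List Sort
    aggRes   : AggSym → Sort

-- A set Π of defined predicate symbols (disjoint from Σ by construction:
-- they are a separate type).
record DefinedPreds (Sig : Signature) : Set₁ where
  open Signature Sig
  field
    PiSym  : Set
    piArgs : PiSym → List Sort

module _ (Sig : Signature) where
  open Signature Sig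

  mutual
    data Term (Γ : List Sort) : Sort → Set where
      var : ∀ {s} → s ∈ Γ → Term Γ s
      app : (f : FunSym) → Terms Γ (funArgs f) → Term Γ (funRes f)

    data Terms (Γ : List Sort) : List Sort → Set where
      []  : Terms Γ []
      _∷_ : ∀ {s ss} → Term Γ s → Terms Γ ss → Terms Γ (s ∷ ss)

  -- Σ(Π)-aggregate formulas.  The set expression {(x₁,…,xₙ) | φ} of an
  -- aggregate atom  R({x̄ | φ}, t)  binds n variables of sorts aggTuple R,
  -- so φ lives in context  aggTuple R ++ Γ.
  module _ (Π : DefinedPreds Sig) where
    open DefinedPreds Π

    data Formula (Γ : List Sort) : Set where
      atom   : (p : PredSym) → Terms Γ (predArgs p) → Formula Γ
      piAtom : (q : PiSym) → Terms Γ (piArgs q) → Formula Γ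
      aggAtom : (R : AggSym) → Formula (aggTuple R ++ Γ) → Term Γ (aggRes R) → Formula Γ
      ¬'_    : Formula Γ → Formula Γ
      _∧'_   : Formula Γ → Formula Γ → Formula Γ
      _∨'_   : Formula Γ → Formula Γ → Formula Γ
      ∀'     : (s : Sort) → Formula (s ∷ Γ) → Formula Γ
      ∃'     : (s : Sort) → Formula (s ∷ Γ) → Formula Γ

    record Rule : Set where
      field
        ctx      : List Sort
        headSym  : PiSym
        headArgs : Terms ctx (piArgs headSym)
        body     : Formula ctx

    Program : Set₁
    Program = Rule → Set

module _ {D₁ D₂ : Set} where
  SubsetOf : Set → Set₁
  SubsetOf A = A → Set

  _⊆ₛ_ : SubsetOf D₁ → SubsetOf D₁ → Set
  S₁ ⊆ₛ S₂ = ∀ d → S₁ d → S₂ d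

  AggRelation : Set₁
  AggRelation = SubsetOf D₁ → D₂ → Set

  Monotone : AggRelation → Set₁
  Monotone R = ∀ S₁ S₂ d → R S₁ d → S₁ ⊆ₛ S₂ → R S₂ d

  AntiMonotone : AggRelation → Set₁
  AntiMonotone R = ∀ S₁ S₂ d → R S₂ d → S₁ ⊆ₛ S₂ → R S₁ d

  -- Since subsets are predicates, an aggregate relation must respect
  -- extensional equality of sets (as any relation on P(D₁) does).
  Extensional : AggRelation → Set₁
  Extensional R = ∀ S₁ S₂ d → S₁ ⊆ₛ S₂ → S₂ ⊆ₛ S₁ → R S₁ d → R S₂ d

record Structure (Sig : Signature) : Set₁ where
  open Signature Sig
  field
    Dom : Sort → Set
  Tuple : List Sort → Set
  Tuple ss = All Dom ss
  field
    funI  : (f : FunSym) → Tuple (funArgs f) → Dom (funRes f)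
    predI : (p : PredSym) → Tuple (predArgs p) → Set
    aggI  : (R : AggSym) → AggRelation {Tuple (aggTuple R)} {Dom (aggRes R)}
    aggI-ext : (R : AggSym) → Extensional (aggI R)

module Semantics {Sig : Signature} (Π : DefinedPreds Sig) (𝒟 : Structure Sig) where
  open Signature Sig
  open DefinedPreds Π
  open Structure 𝒟

  Env : List Sort → Set
  Env = Tuple

  appendT : ∀ {ss Γ} → Tuple ss → Env Γ → Env (ss ++ Γ)
  appendT []       ρ = ρ
  appendT (d ∷ ds) ρ = d ∷ appendT ds ρ

  mutual
    evalTerm : ∀ {Γ s} → Env Γ → Term Sig Γ s → Dom s
    evalTerm ρ (var x)    = All.lookup ρ x
    evalTerm ρ (app f ts) = funI f (evalTerms ρ ts)

    evalTerms : ∀ {Γ ss} → Env Γ → Terms Sig Γ ss → Tuple ss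
    evalTerms ρ []       = []
    evalTerms ρ (t ∷ ts) = evalTerm ρ t ∷ evalTerms ρ ts

  -- Interpretations: subsets of base_𝒟(Π), i.e. sets of ground Π-atoms
  -- q(d̄) with d̄ domain elements.
  Interpretation : Set₁
  Interpretation = (q : PiSym) → Tuple (piArgs q) → Set

  _⊆_ : Interpretation → Interpretation → Set
  I ⊆ J = ∀ q ds → I q ds → J q ds

  sat : ∀ {Γ} → Interpretation → Formula Sig Π Γ → Env Γ → Set
  sat I (atom p ts)     ρ = predI p (evalTerms ρ ts)
  sat I (piAtom q ts)   ρ = I q (evalTerms ρ ts)
  sat I (aggAtom R φ t) ρ = aggI R (λ ds → sat I φ (appendT ds ρ)) (evalTerm ρ t)
  sat I (¬' φ)          ρ = ¬ sat I φ ρ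
  sat I (φ ∧' ψ)        ρ = sat I φ ρ × sat I ψ ρ
  sat I (φ ∨' ψ)        ρ = sat I φ ρ ⊎ sat I ψ ρ
  sat I (∀' s φ)        ρ = (d : Dom s) → sat I φ (d ∷ ρ)
  sat I (∃' s φ)        ρ = Σ (Dom s) λ d → sat I φ (d ∷ ρ)

  data PiFree {Γ} : Formula Sig Π Γ → Set₁ where
    atom    : ∀ p ts → PiFree (atom p ts)
    aggAtom : ∀ R {φ} t → PiFree φ → PiFree (aggAtom R φ t)
    ¬'_     : ∀ {φ} → PiFree φ → PiFree (¬' φ)
    _∧'_    : ∀ {φ ψ} → PiFree φ → PiFree ψ → PiFree (φ ∧' ψ)
    _∨'_    : ∀ {φ ψ} → PiFree φ → PiFree ψ → PiFree (φ ∨' ψ)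
    ∀'      : ∀ s {φ} → PiFree φ → PiFree (∀' s φ)
    ∃'      : ∀ s {φ} → PiFree φ → PiFree (∃' s φ)

  -- An aggregate atom counts as flipping polarity iff its relation is
  -- anti-monotone; it is "neutral" iff neither monotone nor anti-monotone,
  -- in which case its condition must contain no Π-predicate.
  mutual
    data Positive {Γ} : Formula Sig Π Γ → Set₁ where
      atom      : ∀ p ts → Positive (atom p ts)
      piAtom    : ∀ q ts → Positive (piAtom q ts)
      aggMono   : ∀ R {φ} t → Monotone (aggI R) → ¬ AntiMonotone (aggI R) →
                  Positive φ → Positive (aggAtom R φ t)
      aggAnti   : ∀ R {φ} t → AntiMonotone (aggI R) →
                  Negative φ → Positive (aggAtom R φ t)
      aggFree   : ∀ R {φ} t → PiFree φ → Positive (aggAtom R φ t)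
      ¬'_       : ∀ {φ} → Negative φ → Positive (¬' φ)
      _∧'_      : ∀ {φ ψ} → Positive φ → Positive ψ → Positive (φ ∧' ψ)
      _∨'_      : ∀ {φ ψ} → Positive φ → Positive ψ → Positive (φ ∨' ψ)
      ∀'        : ∀ s {φ} → Positive φ → Positive (∀' s φ)
      ∃'        : ∀ s {φ} → Positive φ → Positive (∃' s φ)

    data Negative {Γ} : Formula Sig Π Γ → Set₁ where
      atom      : ∀ p ts → Negative (atom p ts)
      aggMono   : ∀ R {φ} t → Monotone (aggI R) → ¬ AntiMonotone (aggI R) →
                  Negative φ → Negative (aggAtom R φ t)
      aggAnti   : ∀ R {φ} t → AntiMonotone (aggI R) →
                  Positive φ → Negative (aggAtom R φ t)
      aggFree   : ∀ R {φ} t → PiFree φ → Negative (aggAtom R φ t)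
      ¬'_       : ∀ {φ} → Positive φ → Negative (¬' φ)
      _∧'_      : ∀ {φ ψ} → Negative φ → Negative ψ → Negative (φ ∧' ψ)
      _∨'_      : ∀ {φ ψ} → Negative φ → Negative ψ → Negative (φ ∨' ψ)
      ∀'        : ∀ s {φ} → Negative φ → Negative (∀' s φ)
      ∃'        : ∀ s {φ} → Negative φ → Negative (∃' s φ)

  Definite : Program Sig Π → Set₁
  Definite P = ∀ r → P r → Positive (Rule.body r)

  GroundAtom : Set
  GroundAtom = Σ PiSym λ q → Tuple (piArgs q)

  -- T_{P,𝒟}(I) = { A | A ← φ ∈ inst_𝒟(P), 𝒟(I) ⊨ φ }.
  -- A ground instance of rule r is obtained by an assignment ρ of domain
  -- elements to the variables of r.
  T : Program Sig Π → Interpretation → Interpretation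
  T P I q ds =
    Σ (Rule Sig Π) λ r → P r × Σ (Env (Rule.ctx r)) λ ρ →
      ((Rule.headSym r , evalTerms ρ (Rule.headArgs r)) ≡ (q , ds)) × sat I (Rule.body r) ρ

-- A positive body stays true when I grows and a negative one when I shrinks, by simultaneous
-- induction on the polarity derivation: a monotone aggregate passes the inclusion of its
-- condition sets through, an anti-monotone one needs the reverse inclusion and so flips the
-- polarity, and an aggregate whose condition is Π-free denotes the same set under every
-- interpretation, which suffices because aggregate relations are extensional.
{-# OPTIONS --safe #-}
module Submission where

open import Defs
open import Data.Product using (_,_)
open import Data.Sum using (inj₁; inj₂)

module _ {Sig : Signature} {Π : DefinedPreds Sig} {𝒟 : Structure Sig} where
  open Structure 𝒟 using (aggI; aggI-ext)
  open Semantics Π 𝒟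

  PiFree⇒sat-invariant : ∀ {Γ} {φ : Formula Sig Π Γ} → PiFree φ →
                         ∀ I J {ρ} → sat I φ ρ → sat J φ ρ
  PiFree⇒sat-invariant (atom p ts) I J h = h
  PiFree⇒sat-invariant (aggAtom R t φ) I J h =
    aggI-ext R _ _ _ (λ _ → PiFree⇒sat-invariant φ I J)
                     (λ _ → PiFree⇒sat-invariant φ J I) h
  PiFree⇒sat-invariant (¬' φ) I J h = λ hJ → h (PiFree⇒sat-invariant φ J I hJ)
  PiFree⇒sat-invariant (φ ∧' ψ) I J (hφ , hψ) =
    PiFree⇒sat-invariant φ I J hφ , PiFree⇒sat-invariant ψ I J hψ
  PiFree⇒sat-invariant (φ ∨' ψ) I J (inj₁ h) = inj₁ (PiFree⇒sat-invariant φ I J h)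
  PiFree⇒sat-invariant (φ ∨' ψ) I J (inj₂ h) = inj₂ (PiFree⇒sat-invariant ψ I J h)
  PiFree⇒sat-invariant (∀' s φ) I J h = λ d → PiFree⇒sat-invariant φ I J (h d)
  PiFree⇒sat-invariant (∃' s φ) I J (d , h) = d , PiFree⇒sat-invariant φ I J h

  mutual
    Positive⇒sat-monotone : ∀ {Γ} {φ : Formula Sig Π Γ} → Positive φ →
                            ∀ {I J} → I ⊆ J → ∀ {ρ} → sat I φ ρ → sat J φ ρ
    Positive⇒sat-monotone (atom p ts) I⊆J h = h
    Positive⇒sat-monotone (piAtom q ts) I⊆J h = I⊆J q _ h
    Positive⇒sat-monotone (aggMono R t mono _ φ) I⊆J h =
      mono _ _ _ h (λ _ → Positive⇒sat-monotone φ I⊆J)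
    Positive⇒sat-monotone (aggAnti R t anti φ) I⊆J h =
      anti _ _ _ h (λ _ → Negative⇒sat-antitone φ I⊆J)
    Positive⇒sat-monotone (aggFree R t φ) {I} {J} I⊆J h =
      PiFree⇒sat-invariant (aggAtom R t φ) I J h
    Positive⇒sat-monotone (¬' φ) I⊆J h = λ hJ → h (Negative⇒sat-antitone φ I⊆J hJ)
    Positive⇒sat-monotone (φ ∧' ψ) I⊆J (hφ , hψ) =
      Positive⇒sat-monotone φ I⊆J hφ , Positive⇒sat-monotone ψ I⊆J hψ
    Positive⇒sat-monotone (φ ∨' ψ) I⊆J (inj₁ h) = inj₁ (Positive⇒sat-monotone φ I⊆J h)
    Positive⇒sat-monotone (φ ∨' ψ) I⊆J (inj₂ h) = inj₂ (Positive⇒sat-monotone ψ I⊆J h)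
    Positive⇒sat-monotone (∀' s φ) I⊆J h = λ d → Positive⇒sat-monotone φ I⊆J (h d)
    Positive⇒sat-monotone (∃' s φ) I⊆J (d , h) = d , Positive⇒sat-monotone φ I⊆J h

    Negative⇒sat-antitone : ∀ {Γ} {φ : Formula Sig Π Γ} → Negative φ →
                            ∀ {I J} → I ⊆ J → ∀ {ρ} → sat J φ ρ → sat I φ ρ
    Negative⇒sat-antitone (atom p ts) I⊆J h = h
    Negative⇒sat-antitone (aggMono R t mono _ φ) I⊆J h =
      mono _ _ _ h (λ _ → Negative⇒sat-antitone φ I⊆J)
    Negative⇒sat-antitone (aggAnti R t anti φ) I⊆J h =
      anti _ _ _ h (λ _ → Positive⇒sat-monotone φ I⊆J)
    Negative⇒sat-antitone (aggFree R t φ) {I} {J} I⊆J h =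
      PiFree⇒sat-invariant (aggAtom R t φ) J I h
    Negative⇒sat-antitone (¬' φ) I⊆J h = λ hI → h (Positive⇒sat-monotone φ I⊆J hI)
    Negative⇒sat-antitone (φ ∧' ψ) I⊆J (hφ , hψ) =
      Negative⇒sat-antitone φ I⊆J hφ , Negative⇒sat-antitone ψ I⊆J hψ
    Negative⇒sat-antitone (φ ∨' ψ) I⊆J (inj₁ h) = inj₁ (Negative⇒sat-antitone φ I⊆J h)
    Negative⇒sat-antitone (φ ∨' ψ) I⊆J (inj₂ h) = inj₂ (Negative⇒sat-antitone ψ I⊆J h)
    Negative⇒sat-antitone (∀' s φ) I⊆J h = λ d → Negative⇒sat-antitone φ I⊆J (h d)
    Negative⇒sat-antitone (∃' s φ) I⊆J (d , h) = d , Negative⇒sat-antitone φ I⊆J h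

theorem4 : (Sig : Signature) (𝒟 : Structure Sig) (Π : DefinedPreds Sig)
           (P : Program Sig Π) →
           Semantics.Definite Π 𝒟 P →
           ∀ I J → Semantics._⊆_ Π 𝒟 I J →
           Semantics._⊆_ Π 𝒟 (Semantics.T Π 𝒟 P I) (Semantics.T Π 𝒟 P J)
theorem4 Sig 𝒟 Π P definite I J I⊆J q ds (r , r∈P , ρ , head≡ , body) =
  r , r∈P , ρ , head≡ , Positive⇒sat-monotone (definite r r∈P) I⊆J body
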